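{- Let $n\ge 2$, $T\subseteq\{1,\dots,n-1\}$ and $1\le i,j\le n$. If $f$ and $f'$ are flags of type $T$ of $[n]$ that are non-opposite, then $S_{i,j}(f)$ and $S_{i,j}(f')$ are also non-opposite.
   Context: $[n]=\{1,\dots,n\}$. Two subsets $X,Y\subseteq[n]$ are opposite if $X\cap Y=\emptyset$ or $X\cup Y=[n]$. A flag of $[n]$ of type $T$ is a chain (w.r.t. inclusion) of non-empty proper subsets of $[n]$ whose set of cardinalities is $T$; it is written as a tuple $f=(F_1,\dots,F_t)$ with $|T|=t$. Two flags are opposite if every member of one is opposite to every member of the other. For $A\subseteq[n]$, the shift $S_{i,j}(A)$ equals $(A\setminus\{i\})\cup\{j\}$ if $i\in A$ and $j\notin A$, and equals $A$ otherwise; for a flag, $S_{i,j}(f)=(S_{i,j}(F_1),\dots,S_{i,j}(F_t))$. -}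

module Defs where

open import Data.Nat using (ℕ; _≤_; _<_; _∸_)
open import Data.Fin using (Fin)
open import Data.Fin.Subset using (Subset; _∈_; _∉_; _⊆_; _⊂_; _∩_; _∪_; ⊥; ⊤; ∣_∣; Nonempty)
open import Data.Vec using (_[_]≔_)
open import Data.Bool using (true; false)
open import Data.Product using (_×_)
open import Data.Sum using (_⊎_)
open import Data.List using (List; map)
open import Data.List.Relation.Unary.All using (All)
open import Data.List.Relation.Unary.Linked using (Linked)
open import Relation.Binary.PropositionalEquality using (_≡_)
open import Relation.Nullary using (¬_)
open import Relation.Nullary.Decidable using (does)
open import Data.Fin.Subset.Properties using (_∈?_)

-- Elements 1..n of [n] are represented by Fin n (element k ↦ index k-1);
-- subsets of [n] by Subset n.

Opposite : ∀ {n} → Subset n → Subset n → Set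
Opposite X Y = (X ∩ Y ≡ ⊥) ⊎ (X ∪ Y ≡ ⊤)

IsType : ℕ → List ℕ → Set
IsType n T = Linked _<_ T × All (λ k → 1 ≤ k × k ≤ n ∸ 1) T

NonemptyProper : ∀ {n} → Subset n → Set
NonemptyProper X = Nonempty X × X ⊂ ⊤

IsFlag : ∀ n → List ℕ → List (Subset n) → Set
IsFlag n T f = All NonemptyProper f × Linked _⊆_ f × map ∣_∣ f ≡ T

OppositeFlags : ∀ {n} → List (Subset n) → List (Subset n) → Set
OppositeFlags f f' = All (λ F → All (λ F' → Opposite F F') f') f

shift : ∀ {n} → Fin n → Fin n → Subset n → Subset n
shift i j A with does (i ∈? A) | does (j ∈? A)
... | true  | false = (A [ i ]≔ false) [ j ]≔ true
... | _     | _     = A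

shiftFlag : ∀ {n} → Fin n → Fin n → List (Subset n) → List (Subset n)
shiftFlag i j = map (shift i j)

module Submission where

open import Defs
open import Data.Nat using (ℕ; _≤_)
open import Data.Fin using (Fin)
open import Data.Fin.Properties using (_≟_)
open import Data.Fin.Subset using (Subset; inside; outside; _∈_; _∉_; _∩_; _∪_; ⊥; ⊤)
open import Data.Fin.Subset.Properties
  using (_∈?_; Empty-unique; ∉⊥; ∈⊤; ⊆⊤; ⊆-antisym; x∈p∩q⁺; x∈p∩q⁻; x∈p∪q⁺; x∈p∪q⁻)
open import Data.Vec using (lookup; _[_]≔_)
open import Data.Vec.Properties
  using (lookup∘update′; []=⇒lookup; lookup⇒[]=; []=-injective; []≔-updates; []≔-minimal)
open import Data.List using (List)
open import Data.List.Relation.Unary.All as All using ()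
open import Data.List.Relation.Unary.All.Properties using (map⁻)
open import Data.Product using (∃; _×_; _,_)
open import Data.Sum using (_⊎_; inj₁; inj₂)
open import Relation.Binary.PropositionalEquality using (_≡_; _≢_; refl; sym; trans; subst)
open import Relation.Nullary using (¬_; yes; no; contradiction)
open import Function using (_∘′_)

-- Shifting moves every point of [n] in at most one direction: it can only
-- enter j and only leave i.  Hence a point common to X and Y yields one common
-- to S X and S Y (itself, or j), and a point missed by both X and Y yields one
-- missed by both S X and S Y (itself, or i).  So S reflects opposition of
-- sets, and therefore of arbitrary families of sets.

module _ {n : ℕ} (i j : Fin n) where

  lookup-shift : ∀ A {k} → k ≢ i → k ≢ j → lookup (shift i j A) k ≡ lookup A k
  lookup-shift A k≢i k≢j with i ∈? A | j ∈? A
  ... | yes _ | no  _ = trans (lookup∘update′ k≢j (A [ i ]≔ outside) inside)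
                              (lookup∘update′ k≢i A outside)
  ... | yes _ | yes _ = refl
  ... | no  _ | _     = refl

  ∈-shift-other : ∀ {A k} → k ≢ i → k ≢ j → k ∈ A → k ∈ shift i j A
  ∈-shift-other {A} {k} k≢i k≢j k∈A =
    lookup⇒[]= k _ (trans (lookup-shift A k≢i k≢j) ([]=⇒lookup k∈A))

  ∉-shift-other : ∀ {A k} → k ≢ i → k ≢ j → k ∉ A → k ∉ shift i j A
  ∉-shift-other {A} {k} k≢i k≢j k∉A k∈SA =
    k∉A (lookup⇒[]= k A (trans (sym (lookup-shift A k≢i k≢j)) ([]=⇒lookup k∈SA)))

  j∈shift : ∀ {A} → i ∈ A ⊎ j ∈ A → j ∈ shift i j A
  j∈shift {A} i∈A⊎j∈A with i ∈? A | j ∈? A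
  ... | yes _ | no  _   = []≔-updates (A [ i ]≔ outside) j
  ... | yes _ | yes j∈A = j∈A
  ... | no  _ | yes j∈A = j∈A
  ... | no i∉A | no j∉A with i∈A⊎j∈A
  ...   | inj₁ i∈A = contradiction i∈A i∉A
  ...   | inj₂ j∈A = contradiction j∈A j∉A

  i∉shift : ∀ {A} → i ∉ A ⊎ j ∉ A → i ∉ shift i j A
  i∉shift {A} i∉A⊎j∉A with i ∈? A | j ∈? A
  ... | no  i∉A | _      = i∉A
  ... | yes i∈A | yes j∈A with i∉A⊎j∉A
  ...   | inj₁ i∉A = contradiction i∈A i∉A
  ...   | inj₂ j∉A = contradiction j∈A j∉A
  i∉shift {A} _ | yes i∈A | no j∉A with i ≟ j
  ...   | yes refl = contradiction i∈A j∉A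
  ...   | no  i≢j  = λ i∈SA → inside≢outside
                       ([]=-injective i∈SA ([]≔-minimal (A [ i ]≔ outside) i j i≢j ([]≔-updates A i)))
    where
    inside≢outside : inside ≢ outside
    inside≢outside ()

  shift-common-member : ∀ {X Y k} → k ∈ X → k ∈ Y → ∃ λ m → m ∈ shift i j X × m ∈ shift i j Y
  shift-common-member {k = k} k∈X k∈Y with k ≟ i | k ≟ j
  ... | yes refl | _        = j , j∈shift (inj₁ k∈X) , j∈shift (inj₁ k∈Y)
  ... | no  _    | yes refl = j , j∈shift (inj₂ k∈X) , j∈shift (inj₂ k∈Y)
  ... | no  k≢i  | no  k≢j  = k , ∈-shift-other k≢i k≢j k∈X , ∈-shift-other k≢i k≢j k∈Y

  shift-common-nonmember : ∀ {X Y k} → k ∉ X → k ∉ Y → ∃ λ m → m ∉ shift i j X × m ∉ shift i j Y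
  shift-common-nonmember {k = k} k∉X k∉Y with k ≟ i | k ≟ j
  ... | yes refl | _        = i , i∉shift (inj₁ k∉X) , i∉shift (inj₁ k∉Y)
  ... | no  _    | yes refl = i , i∉shift (inj₂ k∉X) , i∉shift (inj₂ k∉Y)
  ... | no  k≢i  | no  k≢j  = k , ∉-shift-other k≢i k≢j k∉X , ∉-shift-other k≢i k≢j k∉Y

  shift-reflects-disjoint : ∀ X Y → shift i j X ∩ shift i j Y ≡ ⊥ → X ∩ Y ≡ ⊥
  shift-reflects-disjoint X Y SX∩SY≡⊥ = Empty-unique λ where
    (k , k∈X∩Y) → let k∈X , k∈Y = x∈p∩q⁻ X Y k∈X∩Y
                      m , m∈SX , m∈SY = shift-common-member k∈X k∈Y
                  in ∉⊥ (subst (m ∈_) SX∩SY≡⊥ (x∈p∩q⁺ (m∈SX , m∈SY)))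

  shift-reflects-covering : ∀ X Y → shift i j X ∪ shift i j Y ≡ ⊤ → X ∪ Y ≡ ⊤
  shift-reflects-covering X Y SX∪SY≡⊤ = ⊆-antisym ⊆⊤ (λ {k} _ → covered k)
    where
    covered : ∀ k → k ∈ X ∪ Y
    covered k with k ∈? X | k ∈? Y
    ... | yes k∈X | _       = x∈p∪q⁺ (inj₁ k∈X)
    ... | no  _   | yes k∈Y = x∈p∪q⁺ (inj₂ k∈Y)
    ... | no  k∉X | no  k∉Y with shift-common-nonmember k∉X k∉Y
    ...   | m , m∉SX , m∉SY with x∈p∪q⁻ (shift i j X) (shift i j Y) (subst (m ∈_) (sym SX∪SY≡⊤) ∈⊤)
    ...     | inj₁ m∈SX = contradiction m∈SX m∉SX
    ...     | inj₂ m∈SY = contradiction m∈SY m∉SY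

  shift-reflects-opposite : ∀ X Y → Opposite (shift i j X) (shift i j Y) → Opposite X Y
  shift-reflects-opposite X Y (inj₁ disjoint) = inj₁ (shift-reflects-disjoint X Y disjoint)
  shift-reflects-opposite X Y (inj₂ covering) = inj₂ (shift-reflects-covering X Y covering)

  shiftFlag-reflects-opposite : ∀ f f' → OppositeFlags (shiftFlag i j f) (shiftFlag i j f') →
                                OppositeFlags f f'
  shiftFlag-reflects-opposite f f' opposite =
    All.map (λ {F} → All.map (λ {F'} → shift-reflects-opposite F F') ∘′ map⁻) (map⁻ opposite)

lemma2p10 : (n : ℕ) → 2 ≤ n → (T : List ℕ) → IsType n T →
    (i j : Fin n) → (f f' : List (Subset n)) → IsFlag n T f → IsFlag n T f' →
    ¬ OppositeFlags f f' → ¬ OppositeFlags (shiftFlag i j f) (shiftFlag i j f')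
lemma2p10 n _ T _ i j f f' _ _ nonOpposite =
  nonOpposite ∘′ shiftFlag-reflects-opposite i j f f'
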